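{- Let $k\ge2$, $n=2^k$, and consider the RBO receiver with data as in the context. If $t'=s$, then $\left|\bigcup_{t\in Y_0}L_t\right|\le l_0+1$.
   Context: $[[a,b]]=\{x\in\mathbb Z: a\le x\le b\}$. For an integer $x$, $\mathrm{rev}_k(x)$ is the integer in $[[0,2^k-1]]$ whose $k$-bit binary representation is the reversal of the $k$-bit binary representation of $x\bmod 2^k$. RBO protocol: real keys $\kappa_0\le\dots\le\kappa_{n-1}$; at every time slot $t=0,1,2,\dots$ the broadcaster transmits $\kappa_{\mathrm{rev}_k(t)}$. A receiver with query reals $-\infty<\kappa'\le\kappa''<+\infty$ starts at time slot $s\in[[0,n-1]]$ with $\mathrm{lb}=0$, $\mathrm{ub}=n-1$, and at each slot $t\ge s$: if $\mathrm{lb}\le\mathrm{rev}_k(t)\le\mathrm{ub}$ it receives $\kappa=\kappa_{\mathrm{rev}_k(t)}$; if $\kappa<\kappa'$ it sets $\mathrm{lb}:=\mathrm{rev}_k(t)+1$; if $\kappa''<\kappa$ it sets $\mathrm{ub}:=\mathrm{rev}_k(t)-1$. Let $\mathrm{lb}_t$ be the value of $\mathrm{lb}$ just before time slot $t$ (so $\mathrm{lb}_t=0$ for $t\le s$), and for $t\ge s$ let $L_t=\{\mathrm{lb}_{t+1}-1\}\setminus\{\mathrm{lb}_t-1\}$. Let $t'=\min\{t\in[[s,s+n-1]]:\mathrm{lb}_{t+1}>0\}$. Let $t_0=s$, $l_0=\max\{l\in[[0,k]]:s\equiv0\pmod{2^l}\}$ and $Y_0=[[s,s+2^{l_0}-1]]$.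 -}

module Defs where

open import Level using (Level)
open import Data.Nat as ℕ using (ℕ; zero; suc; _^_; _%_; _/_)
open import Data.Integer as ℤ using (ℤ; +_; _-_; _+_)
open import Data.Product using (_×_; _,_; proj₁)
open import Relation.Nullary using (yes; no)
open import Relation.Binary.Bundles using (StrictTotalOrder)

rev : ℕ → ℕ → ℕ
rev zero    x = 0
rev (suc k) x = (x % 2) ℕ.* (2 ^ k) ℕ.+ rev k (x / 2)

IsMax : (ℕ → Set) → ℕ → Set
IsMax P m = P m × (∀ l → P l → l ℕ.≤ m)

IsMin : (ℕ → Set) → ℕ → Set
IsMin P m = P m × (∀ l → P l → m ℕ.≤ l)

module RBO {a ℓ₁ ℓ₂ : Level} (O : StrictTotalOrder a ℓ₁ ℓ₂) where
  open StrictTotalOrder O renaming (Carrier to K)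

  -- One receiver step at time slot t, from state (lb , ub).
  -- keys : the broadcast keys (only indices in [[0,n-1]] are ever read),
  -- κ' κ'' : the query bounds.
  step : ℕ → (ℕ → K) → K → K → ℕ → ℤ × ℤ → ℤ × ℤ
  step k keys κ' κ'' t (lb , ub) with lb ℤ.≤? (+ rev k t) | (+ rev k t) ℤ.≤? ub
  ... | yes _ | yes _ with keys (rev k t) <? κ' | κ'' <? keys (rev k t)
  ...   | yes _ | _     = ((+ rev k t) + + 1 , ub)
  ...   | no _  | yes _ = (lb , (+ rev k t) - + 1)
  ...   | no _  | no _  = (lb , ub)
  step k keys κ' κ'' t (lb , ub) | _ | _ = (lb , ub)

  -- state k n keys κ' κ'' s m : the pair (lb , ub) just before time slot s + m,
  -- for a receiver starting at slot s with lb = 0, ub = n - 1.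
  state : ℕ → ℕ → (ℕ → K) → K → K → ℕ → ℕ → ℤ × ℤ
  state k n keys κ' κ'' s zero    = (+ 0 , (+ n) - + 1)
  state k n keys κ' κ'' s (suc m) = step k keys κ' κ'' (s ℕ.+ m) (state k n keys κ' κ'' s m)

  -- lb_t : the value of lb just before slot t (equal to 0 for t ≤ s).
  lbAt : ℕ → ℕ → (ℕ → K) → K → K → ℕ → ℕ → ℤ
  lbAt k n keys κ' κ'' s t = proj₁ (state k n keys κ' κ'' s (t ℕ.∸ s))

-- Write the slots of Y₀ as s, and s + 2^h + y with y < 2^h for each h < l₀, and call a slot a hit if its key
-- lies below κ'. Each element of the union is lb_{t+1} − 1 for a slot t at which lb changes, so it suffices
-- that lb changes at most once per block h. A change at t needs lb_t ≤ rev_k t, and lb has already passed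
-- every earlier hit since s, so change slots lie above (in rev_k order) all earlier hits. Since 2^(h+1) divides s,
-- rev_k (s + c·2^h + y) = (c + 2·rev_h y)·2^(k−h−1) + R with R independent of c and y. Changes at
-- s + 2^h + y₁ and s + 2^h + y₂ with y₁ < y₂ would make s + y₂ a hit (its key is no larger than the
-- second change's) lying below the first change, which in turn lies below the second; the formula for
-- rev_k rules out this interleaving.
module Submission where

open import Defs
open import Level using (Level)
open import Data.Nat as ℕ using (ℕ; suc; _^_; _≤_; _<_)
open import Data.Nat.Divisibility using (_∣_)
open import Data.Integer as ℤ using (ℤ; +_; _-_)
open import Data.Product using (_×_; _,_; ∃-syntax)
open import Data.List using (List; length)
open import Data.List.Relation.Unary.All using (All)
open import Data.List.Relation.Unary.Unique.Propositional using (Unique)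
open import Relation.Nullary using (¬_)
open import Relation.Binary.PropositionalEquality using (_≡_; _≢_)
open import Relation.Binary.Bundles using (StrictTotalOrder)

open import Data.Nat using (zero; _+_; _*_; _∸_; _%_; _/_; z≤n; s≤s; s≤s⁻¹; s<s⁻¹; _<?_)
open import Data.Nat.Properties
open import Data.Nat.DivMod using ([m+kn]%n≡m%n; m%n<n; +-distrib-/-∣ʳ; m*n/n≡m; m<n*o⇒m/o<n)
open import Data.Nat.Divisibility using (divides; ∣-trans; m∣m*n)
open import Data.Nat.Tactic.RingSolver using (solve-∀)
open import Data.Integer using (+≤+; +<+)
import Data.Integer.Properties as ℤₚ
open import Data.Fin using (Fin; zero; suc; fromℕ<)
open import Data.Fin.Properties using (injective⇒≤; fromℕ<-injective)
open import Data.List using (lookup; _∷_)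
open import Data.List.Membership.Propositional.Properties using (∈-lookup)
import Data.List.Relation.Unary.All as All
open import Data.List.Relation.Unary.AllPairs using (_∷_)
open import Data.Product using (proj₁; proj₂)
open import Data.Sum using (inj₁; inj₂)
open import Data.Empty using (⊥; ⊥-elim)
open import Relation.Nullary using (yes; no; contradiction)
open import Relation.Binary.PropositionalEquality using (refl; sym; trans; cong; cong₂; subst; subst₂; module ≡-Reasoning)
open import Relation.Binary.Definitions using (tri<; tri≈; tri>)

rev-< : ∀ k x → rev k x < 2 ^ k
rev-< zero    x = s≤s z≤n
rev-< (suc k) x = begin-strict
  x % 2 * 2 ^ k + rev k (x / 2) <⟨ +-monoʳ-< (x % 2 * 2 ^ k) (rev-< k (x / 2)) ⟩
  x % 2 * 2 ^ k + 2 ^ k         ≤⟨ +-monoˡ-≤ (2 ^ k) (*-monoˡ-≤ (2 ^ k) (s≤s⁻¹ (m%n<n x 2))) ⟩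
  1 * 2 ^ k + 2 ^ k             ≡⟨ cong₂ _+_ (*-identityˡ (2 ^ k)) (sym (+-identityʳ (2 ^ k))) ⟩
  2 ^ suc k                     ∎
  where open ≤-Reasoning

[m+n*2]/2≡m/2+n : ∀ m n → (m + n * 2) / 2 ≡ m / 2 + n
[m+n*2]/2≡m/2+n m n = trans (+-distrib-/-∣ʳ m (divides n refl)) (cong (_+_ (m / 2)) (m*n/n≡m n 2))

b^n≡b^m*b^[n∸m] : ∀ b {m n} → m ≤ n → b ^ n ≡ b ^ m * b ^ (n ∸ m)
b^n≡b^m*b^[n∸m] b {m} {n} m≤n = trans (cong (b ^_) (sym (m+[n∸m]≡n m≤n))) (^-distribˡ-+-* b m (n ∸ m))

rev-+-2^* : ∀ m k x b → m ≤ k → x < 2 ^ m →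
            rev k (x + 2 ^ m * b) ≡ rev m x * 2 ^ (k ∸ m) + rev (k ∸ m) b
rev-+-2^* zero    k       zero    b _         _  = cong (rev k) (+-identityʳ b)
rev-+-2^* zero    k       (suc x) b _         (s≤s ())
rev-+-2^* (suc m) (suc k) x       b (s≤s m≤k) x< = begin
  (x + 2 ^ suc m * b) % 2 * 2 ^ k + rev k ((x + 2 ^ suc m * b) / 2)
    ≡⟨ cong (λ y → y % 2 * 2 ^ k + rev k (y / 2)) x+2^[1+m]*b≡x+2^m*b*2 ⟩
  (x + 2 ^ m * b * 2) % 2 * 2 ^ k + rev k ((x + 2 ^ m * b * 2) / 2)
    ≡⟨ cong₂ (λ p q → p * 2 ^ k + rev k q) ([m+kn]%n≡m%n x (2 ^ m * b) 2) ([m+n*2]/2≡m/2+n x (2 ^ m * b)) ⟩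
  x % 2 * 2 ^ k + rev k (x / 2 + 2 ^ m * b)
    ≡⟨ cong (_+_ (x % 2 * 2 ^ k)) (rev-+-2^* m k (x / 2) b m≤k x/2<2^m) ⟩
  x % 2 * 2 ^ k + (rev m (x / 2) * 2 ^ (k ∸ m) + rev (k ∸ m) b)
    ≡⟨ cong (λ p → x % 2 * p + (rev m (x / 2) * 2 ^ (k ∸ m) + rev (k ∸ m) b)) (b^n≡b^m*b^[n∸m] 2 m≤k) ⟩
  x % 2 * (2 ^ m * 2 ^ (k ∸ m)) + (rev m (x / 2) * 2 ^ (k ∸ m) + rev (k ∸ m) b)
    ≡⟨ regroup (x % 2) (2 ^ m) (2 ^ (k ∸ m)) (rev m (x / 2)) (rev (k ∸ m) b) ⟩
  (x % 2 * 2 ^ m + rev m (x / 2)) * 2 ^ (k ∸ m) + rev (k ∸ m) b ∎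
  where
  open ≡-Reasoning
  x+2^[1+m]*b≡x+2^m*b*2 : x + 2 ^ suc m * b ≡ x + 2 ^ m * b * 2
  x+2^[1+m]*b≡x+2^m*b*2 = cong (_+_ x) (2*p*b≡p*b*2 (2 ^ m) b)
    where 2*p*b≡p*b*2 : ∀ p b → 2 * p * b ≡ p * b * 2
          2*p*b≡p*b*2 = solve-∀
  x/2<2^m : x / 2 < 2 ^ m
  x/2<2^m = m<n*o⇒m/o<n (subst (x <_) (*-comm 2 (2 ^ m)) x<)
  regroup : ∀ a p q r c → a * (p * q) + (r * q + c) ≡ (a * p + r) * q + c
  regroup = solve-∀

m+2^n*c<2^[1+n] : ∀ {m n c} → m < 2 ^ n → c ≤ 1 → m + 2 ^ n * c < 2 ^ suc n
m+2^n*c<2^[1+n] {m} {n} {c} m< c≤1 = begin-strict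
  m + 2 ^ n * c       <⟨ +-mono-<-≤ m< (*-monoʳ-≤ (2 ^ n) c≤1) ⟩
  2 ^ n + 2 ^ n * 1   ≡⟨ cong (_+_ (2 ^ n)) (trans (*-identityʳ (2 ^ n)) (sym (+-identityʳ (2 ^ n)))) ⟩
  2 ^ suc n           ∎
  where open ≤-Reasoning

rev-1 : ∀ {c} → c ≤ 1 → rev 1 c ≡ c
rev-1 z≤n       = refl
rev-1 (s≤s z≤n) = refl

rev-block : ∀ k h B c y → h < k → c ≤ 1 → y < 2 ^ h →
            rev k (B * 2 ^ suc h + (2 ^ h * c + y)) ≡ (c + rev h y * 2) * 2 ^ (k ∸ suc h) + rev (k ∸ suc h) B
rev-block k h B c y h<k c≤1 y< = begin
  rev k (B * 2 ^ suc h + (2 ^ h * c + y))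
    ≡⟨ cong (rev k) (swap (2 ^ h * c) y B (2 ^ suc h)) ⟩
  rev k (y + 2 ^ h * c + 2 ^ suc h * B)
    ≡⟨ rev-+-2^* (suc h) k (y + 2 ^ h * c) B h<k (m+2^n*c<2^[1+n] {n = h} y< c≤1) ⟩
  rev (suc h) (y + 2 ^ h * c) * 2 ^ (k ∸ suc h) + rev (k ∸ suc h) B
    ≡⟨ cong (λ r → r * 2 ^ (k ∸ suc h) + rev (k ∸ suc h) B) (rev-+-2^* h (suc h) y c (n≤1+n h) y<) ⟩
  (rev h y * 2 ^ (suc h ∸ h) + rev (suc h ∸ h) c) * 2 ^ (k ∸ suc h) + rev (k ∸ suc h) B
    ≡⟨ cong (λ e → (rev h y * 2 ^ e + rev e c) * 2 ^ (k ∸ suc h) + rev (k ∸ suc h) B) (m+n∸n≡m 1 h) ⟩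
  (rev h y * 2 + rev 1 c) * 2 ^ (k ∸ suc h) + rev (k ∸ suc h) B
    ≡⟨ cong (λ r → r * 2 ^ (k ∸ suc h) + rev (k ∸ suc h) B) (trans (cong (_+_ (rev h y * 2)) (rev-1 c≤1)) (+-comm (rev h y * 2) c)) ⟩
  (c + rev h y * 2) * 2 ^ (k ∸ suc h) + rev (k ∸ suc h) B ∎
  where
  open ≡-Reasoning
  swap : ∀ a y B p → B * p + (a + y) ≡ y + a + p * B
  swap = solve-∀

rev-block₀ : ∀ {k h} B {y} → h < k → y < 2 ^ h →
             rev k (B * 2 ^ suc h + y) ≡ rev h y * 2 * 2 ^ (k ∸ suc h) + rev (k ∸ suc h) B
rev-block₀ {k} {h} B {y} h<k y< =
  trans (cong (λ z → rev k (B * 2 ^ suc h + (z + y))) (sym (*-zeroʳ (2 ^ h)))) (rev-block k h B 0 y h<k z≤n y<)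

rev-block₁ : ∀ {k h} B {y} → h < k → y < 2 ^ h →
             rev k (B * 2 ^ suc h + (2 ^ h + y)) ≡ suc (rev h y * 2) * 2 ^ (k ∸ suc h) + rev (k ∸ suc h) B
rev-block₁ {k} {h} B {y} h<k y< =
  trans (cong (λ z → rev k (B * 2 ^ suc h + (z + y))) (sym (*-identityʳ (2 ^ h)))) (rev-block k h B 1 y h<k (s≤s z≤n) y<)

rev-lower≤rev-upper : ∀ {k h s y} → h < k → 2 ^ suc h ∣ s → y < 2 ^ h →
                      rev k (s + y) ≤ rev k (s + (2 ^ h + y))
rev-lower≤rev-upper {k} {h} {y = y} h<k (divides B refl) y< = begin
  rev k (B * 2 ^ suc h + y)                               ≡⟨ rev-block₀ B h<k y< ⟩
  rev h y * 2 * 2 ^ (k ∸ suc h) + rev (k ∸ suc h) B       ≤⟨ +-monoˡ-≤ _ (*-monoˡ-≤ (2 ^ (k ∸ suc h)) (n≤1+n (rev h y * 2))) ⟩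
  suc (rev h y * 2) * 2 ^ (k ∸ suc h) + rev (k ∸ suc h) B ≡⟨ rev-block₁ B h<k y< ⟨
  rev k (B * 2 ^ suc h + (2 ^ h + y))                     ∎
  where open ≤-Reasoning

-- With all three values of the form (c + rev h y * 2) * 2 ^ (k ∸ suc h) + R, the first inequality forces
-- rev h y₂ ≤ rev h y₁ and the second rev h y₁ < rev h y₂.
rev-upper-not-between : ∀ {k h s y₁ y₂} → h < k → 2 ^ suc h ∣ s → y₁ < 2 ^ h → y₂ < 2 ^ h →
                        rev k (s + y₂) < rev k (s + (2 ^ h + y₁)) →
                        rev k (s + (2 ^ h + y₁)) < rev k (s + (2 ^ h + y₂)) → ⊥
rev-upper-not-between {k} {h} {y₁ = y₁} {y₂} h<k (divides B refl) y₁< y₂< lt₀₁ lt₁₂ =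
  <⇒≱ (*-cancelʳ-< 2 (rev h y₁) (rev h y₂) (s<s⁻¹ (cancel lt₁₂′))) (*-cancelʳ-≤ (rev h y₂) (rev h y₁) 2 (m<1+n⇒m≤n (cancel lt₀₁′)))
  where
  D R : ℕ
  D = 2 ^ (k ∸ suc h)
  R = rev (k ∸ suc h) B
  cancel : ∀ {m n} → m * D + R < n * D + R → m < n
  cancel {m} {n} lt = *-cancelʳ-< D m n (+-cancelʳ-< R (m * D) (n * D) lt)
  lt₀₁′ : rev h y₂ * 2 * D + R < suc (rev h y₁ * 2) * D + R
  lt₀₁′ = subst₂ _<_ (rev-block₀ B h<k y₂<) (rev-block₁ B h<k y₁<) lt₀₁
  lt₁₂′ : suc (rev h y₁ * 2) * D + R < suc (rev h y₂ * 2) * D + R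
  lt₁₂′ = subst₂ _<_ (rev-block₁ B h<k y₁<) (rev-block₁ B h<k y₂<) lt₁₂

^-monoʳ-∣ : ∀ b {m n} → m ≤ n → b ^ m ∣ b ^ n
^-monoʳ-∣ b {m} {n} m≤n = subst (b ^ m ∣_) (sym (b^n≡b^m*b^[n∸m] b m≤n)) (m∣m*n (b ^ (n ∸ m)))

InBlock : ℕ → ℕ → Set
InBlock zero    d = d ≡ 0
InBlock (suc h) d = ∃[ y ] (y < 2 ^ h × d ≡ 2 ^ h + y)

block-of : ∀ l {d} → d < 2 ^ l → ∃[ i ] (i ≤ l × InBlock i d)
block-of zero    {zero}  _         = 0 , z≤n , refl
block-of zero    {suc d} (s≤s ())
block-of (suc l) {d} d< with d <? 2 ^ l
... | yes d<2^l = let i , i≤l , d∈i = block-of l d<2^l in i , m≤n⇒m≤1+n i≤l , d∈i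
... | no  d≮2^l with m≤n⇒∃[o]m+o≡n (≮⇒≥ d≮2^l)
...   | y , refl = suc l , ≤-refl , y , y<2^l , refl
  where
  y<2^l : y < 2 ^ l
  y<2^l = subst (y <_) (+-identityʳ (2 ^ l)) (+-cancelˡ-< (2 ^ l) y (2 ^ l + 0) d<)

Unique-lookup-injective : ∀ {a} {A : Set a} {xs : List A} → Unique xs →
                          ∀ {i j} → lookup xs i ≡ lookup xs j → i ≡ j
Unique-lookup-injective (_   ∷ _) {zero}  {zero}  _  = refl
Unique-lookup-injective (x∉ ∷ _) {zero}  {suc j} eq = ⊥-elim (All.lookup x∉ (∈-lookup j) eq)
Unique-lookup-injective (x∉ ∷ _) {suc i} {zero}  eq = ⊥-elim (All.lookup x∉ (∈-lookup i) (sym eq))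
Unique-lookup-injective (_   ∷ u) {suc i} {suc j} eq = cong suc (Unique-lookup-injective u eq)

length-≤-classes : ∀ {a p} {A : Set a} {P : A → Set p} (N : ℕ) (cls : ∀ {x} → P x → ℕ) →
                   (∀ {x} (px : P x) → cls px < N) →
                   (∀ {x y} (px : P x) (py : P y) → cls px ≡ cls py → x ≡ y) →
                   ∀ {xs} → Unique xs → All P xs → length xs ≤ N
length-≤-classes {P = P} N cls cls<N cls-inj {xs} xs! pxs = injective⇒≤ f-injective
  where
  px : (i : Fin (length xs)) → P (lookup xs i)
  px i = All.lookup pxs (∈-lookup i)
  f : Fin (length xs) → Fin N
  f i = fromℕ< (cls<N (px i))
  f-injective : ∀ {i j} → f i ≡ f j → i ≡ j
  f-injective {i} {j} eq =
    Unique-lookup-injective xs! (cls-inj (px i) (px j) (fromℕ<-injective _ _ (cls<N (px i)) (cls<N (px j)) eq))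

+≤+-1 : ∀ {q r} → q < r → + q ℤ.≤ + r - + 1
+≤+-1 {r = suc r} (s≤s q≤r) = +≤+ q≤r

module Receiver {a ℓ₁ ℓ₂ : Level} (O : StrictTotalOrder a ℓ₁ ℓ₂) (k n : ℕ)
                (keys : ℕ → StrictTotalOrder.Carrier O) (κ' κ'' : StrictTotalOrder.Carrier O)
                (keys-sorted : ∀ i → suc i < n → ¬ StrictTotalOrder._<_ O (keys (suc i)) (keys i))
                (κ'≤κ'' : ¬ StrictTotalOrder._<_ O κ'' κ') (rev<n : ∀ t → rev k t < n) where

  open StrictTotalOrder O renaming (_<_ to _⊏_; _<?_ to _⊏?_; trans to ⊏-trans)
    using (compare; irrefl; <-respʳ-≈; module Eq)
  open RBO O

  ≯-⊏-trans : ∀ {x y z} → ¬ y ⊏ x → y ⊏ z → x ⊏ z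
  ≯-⊏-trans {x} {y} {z} y⊀x y⊏z with compare x z
  ... | tri< x⊏z _ _ = x⊏z
  ... | tri≈ _ x≈z _ = ⊥-elim (y⊀x (<-respʳ-≈ (Eq.sym x≈z) y⊏z))
  ... | tri> _ _ z⊏x = ⊥-elim (y⊀x (⊏-trans y⊏z z⊏x))

  keys-mono : ∀ {i j} → i ≤ j → j < n → ¬ keys j ⊏ keys i
  keys-mono {i} {j} i≤j j<n with m≤n⇒m<n∨m≡n i≤j
  ... | inj₂ refl = irrefl Eq.refl
  ... | inj₁ (s≤s i≤j') = λ kj⊏ki →
    keys-mono i≤j' (<-trans (n<1+n _) j<n) (≯-⊏-trans (keys-sorted _ j<n) kj⊏ki)

  ⊏κ'-downward : ∀ {i j} → i ≤ j → j < n → keys j ⊏ κ' → keys i ⊏ κ'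
  ⊏κ'-downward i≤j j<n = ≯-⊏-trans (keys-mono i≤j j<n)

  hit<cut : ∀ {q r} → q < n → keys q ⊏ κ' → κ'' ⊏ keys r → q < r
  hit<cut {q} {r} q<n hit cut with q <? r
  ... | yes q<r = q<r
  ... | no  q≮r = ⊥-elim (κ'≤κ'' (⊏-trans cut (⊏κ'-downward (≮⇒≥ q≮r) q<n hit)))

  data StepView (t : ℕ) : ℤ × ℤ → ℤ × ℤ → Set ℓ₂ where
    raise : ∀ {lb ub} → lb ℤ.≤ + rev k t → keys (rev k t) ⊏ κ' →
            StepView t (lb , ub) (+ rev k t ℤ.+ + 1 , ub)
    lower : ∀ {lb ub} → κ'' ⊏ keys (rev k t) → StepView t (lb , ub) (lb , + rev k t - + 1)
    stay  : ∀ {lb ub} → (lb ℤ.≤ + rev k t → + rev k t ℤ.≤ ub → ¬ keys (rev k t) ⊏ κ') →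
            StepView t (lb , ub) (lb , ub)

  step-view : ∀ t p → StepView t p (step k keys κ' κ'' t p)
  step-view t (lb , ub) with lb ℤ.≤? (+ rev k t) | (+ rev k t) ℤ.≤? ub
  ... | yes lb≤r | yes _ with keys (rev k t) ⊏? κ' | κ'' ⊏? keys (rev k t)
  ...   | yes hit  | _       = raise lb≤r hit
  ...   | no  _    | yes cut = lower cut
  ...   | no  ¬hit | no  _   = stay (λ _ _ → ¬hit)
  step-view t (lb , ub) | yes _   | no r≰ub = stay (λ _ r≤ub → contradiction r≤ub r≰ub)
  step-view t (lb , ub) | no lb≰r | _       = stay (λ lb≤r → contradiction lb≤r lb≰r)

  UbAboveHits : ℤ × ℤ → Set ℓ₂
  UbAboveHits (_ , ub) = ∀ {q} → q < n → keys q ⊏ κ' → + q ℤ.≤ ub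

  step-lb-mono : ∀ t p → proj₁ p ℤ.≤ proj₁ (step k keys κ' κ'' t p)
  step-lb-mono t p with step k keys κ' κ'' t p | step-view t p
  ... | _ | raise lb≤r _ = ℤₚ.≤-trans lb≤r (+≤+ (m≤m+n (rev k t) 1))
  ... | _ | lower _      = ℤₚ.≤-refl
  ... | _ | stay _       = ℤₚ.≤-refl

  step-ubAboveHits : ∀ t p → UbAboveHits p → UbAboveHits (step k keys κ' κ'' t p)
  step-ubAboveHits t p above with step k keys κ' κ'' t p | step-view t p
  ... | _ | raise _ _ = above
  ... | _ | lower cut = λ q<n hit → +≤+-1 (hit<cut q<n hit cut)
  ... | _ | stay _    = above

  step-passes-hit : ∀ t p → UbAboveHits p → keys (rev k t) ⊏ κ' → + rev k t ℤ.< proj₁ (step k keys κ' κ'' t p)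
  step-passes-hit t p above hit with step k keys κ' κ'' t p | step-view t p
  ... | _ | raise _ _ = +<+ (m<m+n (rev k t) (s≤s z≤n))
  ... | _ | lower cut = ⊥-elim (κ'≤κ'' (⊏-trans cut hit))
  ... | (lb , _) | stay ¬hit with lb ℤ.≤? + rev k t
  ...   | yes lb≤r = ⊥-elim (¬hit lb≤r (above (rev<n t) hit) hit)
  ...   | no  lb≰r = ℤₚ.≰⇒> lb≰r

  step-lb-change : ∀ t p → proj₁ (step k keys κ' κ'' t p) ≢ proj₁ p →
                   proj₁ p ℤ.≤ + rev k t × keys (rev k t) ⊏ κ'
  step-lb-change t p ne with step k keys κ' κ'' t p | step-view t p
  ... | _ | raise lb≤r hit = lb≤r , hit
  ... | _ | lower _        = ⊥-elim (ne refl)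
  ... | _ | stay _         = ⊥-elim (ne refl)

  module From (s : ℕ) where

    st : ℕ → ℤ × ℤ
    st = state k n keys κ' κ'' s

    lb : ℕ → ℤ
    lb = lbAt k n keys κ' κ'' s

    LbChangesAt : ℕ → Set
    LbChangesAt t = lb (suc t) ≢ lb t

    st-ubAboveHits : ∀ m → UbAboveHits (st m)
    st-ubAboveHits zero    q<n _ = +≤+-1 q<n
    st-ubAboveHits (suc m) = step-ubAboveHits (s + m) (st m) (st-ubAboveHits m)

    st-lb-mono : ∀ {m m'} → m ≤ m' → proj₁ (st m) ℤ.≤ proj₁ (st m')
    st-lb-mono {m} {zero}   z≤n = ℤₚ.≤-refl
    st-lb-mono {m} {suc m'} m≤ with m≤n⇒m<n∨m≡n m≤
    ... | inj₁ m<1+m' = ℤₚ.≤-trans (st-lb-mono (s≤s⁻¹ m<1+m')) (step-lb-mono (s + m') (st m'))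
    ... | inj₂ refl   = ℤₚ.≤-refl

    lb-mono : ∀ {t t'} → t ≤ t' → lb t ℤ.≤ lb t'
    lb-mono t≤t' = st-lb-mono (∸-monoˡ-≤ s t≤t')

    lb-suc : ∀ {t} → s ≤ t → lb (suc t) ≡ proj₁ (step k keys κ' κ'' t (st (t ∸ s)))
    lb-suc {t} s≤t = begin
      proj₁ (st (suc t ∸ s))                              ≡⟨ cong (λ m → proj₁ (st m)) (+-∸-assoc 1 s≤t) ⟩
      proj₁ (step k keys κ' κ'' (s + (t ∸ s)) (st (t ∸ s))) ≡⟨ cong (λ u → proj₁ (step k keys κ' κ'' u (st (t ∸ s)))) (m+[n∸m]≡n s≤t) ⟩
      proj₁ (step k keys κ' κ'' t (st (t ∸ s)))            ∎
      where open ≡-Reasoning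

    lb-passes-hit : ∀ {t} → s ≤ t → keys (rev k t) ⊏ κ' → + rev k t ℤ.< lb (suc t)
    lb-passes-hit {t} s≤t hit =
      subst (+ rev k t ℤ.<_) (sym (lb-suc s≤t)) (step-passes-hit t (st (t ∸ s)) (st-ubAboveHits (t ∸ s)) hit)

    lb-change : ∀ {t} → s ≤ t → LbChangesAt t → lb t ℤ.≤ + rev k t × keys (rev k t) ⊏ κ'
    lb-change {t} s≤t ne = step-lb-change t (st (t ∸ s)) (λ eq → ne (trans (lb-suc s≤t) eq))

    hit<change : ∀ {t₀ t₁} → s ≤ t₀ → t₀ < t₁ → keys (rev k t₀) ⊏ κ' → LbChangesAt t₁ → rev k t₀ < rev k t₁
    hit<change s≤t₀ t₀<t₁ hit ch = ℤₚ.drop‿+<+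
      (ℤₚ.<-≤-trans (lb-passes-hit s≤t₀ hit) (ℤₚ.≤-trans (lb-mono t₀<t₁) (proj₁ (lb-change (≤-trans s≤t₀ (<⇒≤ t₀<t₁)) ch))))

    one-change-per-block : ∀ {h y₁ y₂} → h < k → 2 ^ suc h ∣ s → y₁ < y₂ → y₂ < 2 ^ h →
                           LbChangesAt (s + (2 ^ h + y₁)) → LbChangesAt (s + (2 ^ h + y₂)) → ⊥
    one-change-per-block {h} {y₁} {y₂} h<k 2^[1+h]∣s y₁<y₂ y₂< ch₁ ch₂ =
      rev-upper-not-between h<k 2^[1+h]∣s (<-trans y₁<y₂ y₂<) y₂<
        (hit<change (m≤m+n s y₂) t₀<t₁ hit₀ ch₁) (hit<change s≤t₁ t₁<t₂ (proj₂ (lb-change s≤t₁ ch₁)) ch₂)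
      where
      s≤t₁ : s ≤ s + (2 ^ h + y₁)
      s≤t₁ = m≤m+n s (2 ^ h + y₁)
      t₀<t₁ : s + y₂ < s + (2 ^ h + y₁)
      t₀<t₁ = +-monoʳ-< s (<-≤-trans y₂< (m≤m+n (2 ^ h) y₁))
      t₁<t₂ : s + (2 ^ h + y₁) < s + (2 ^ h + y₂)
      t₁<t₂ = +-monoʳ-< s (+-monoʳ-< (2 ^ h) y₁<y₂)
      hit₀ : keys (rev k (s + y₂)) ⊏ κ'
      hit₀ = ⊏κ'-downward (rev-lower≤rev-upper h<k 2^[1+h]∣s y₂<) (rev<n _)
               (proj₂ (lb-change (m≤m+n s (2 ^ h + y₂)) ch₂))

    change-unique-in-block : ∀ {i d₁ d₂} → i ≤ k → 2 ^ i ∣ s → InBlock i d₁ → InBlock i d₂ →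
                             LbChangesAt (s + d₁) → LbChangesAt (s + d₂) → d₁ ≡ d₂
    change-unique-in-block {zero} _ _ refl refl _ _ = refl
    change-unique-in-block {suc h} h<k 2^[1+h]∣s (y₁ , y₁< , refl) (y₂ , y₂< , refl) ch₁ ch₂ with <-cmp y₁ y₂
    ... | tri< y₁<y₂ _ _ = ⊥-elim (one-change-per-block h<k 2^[1+h]∣s y₁<y₂ y₂< ch₁ ch₂)
    ... | tri≈ _ refl _  = refl
    ... | tri> _ _ y₂<y₁ = ⊥-elim (one-change-per-block h<k 2^[1+h]∣s y₂<y₁ y₁< ch₂ ch₁)

lemma4 : {a ℓ₁ ℓ₂ : Level} (O : StrictTotalOrder a ℓ₁ ℓ₂) →
    let open RBO O in
    (k n : ℕ) → 2 ≤ k → n ≡ 2 ^ k →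
    (keys : ℕ → StrictTotalOrder.Carrier O) → (∀ i → suc i < n → ¬ StrictTotalOrder._<_ O (keys (suc i)) (keys i)) →
    (κ' κ'' : StrictTotalOrder.Carrier O) → ¬ StrictTotalOrder._<_ O κ'' κ' →
    (s : ℕ) → s < n →
    let lb = lbAt k n keys κ' κ'' s in
    (t' : ℕ) → IsMin (λ t → (s ≤ t × t ≤ s ℕ.+ n ℕ.∸ 1) × ℤ.0ℤ ℤ.< lb (suc t)) t' →
    (l₀ : ℕ) → IsMax (λ l → l ≤ k × 2 ^ l ∣ s) l₀ →
    t' ≡ s →
    (xs : List ℤ) → Unique xs →
    All (λ x → ∃[ t ] ((s ≤ t × t < s ℕ.+ 2 ^ l₀) ×
    (x ≡ lb (suc t) - + 1 × x ≢ lb t - + 1))) xs →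
    length xs ≤ l₀ ℕ.+ 1
lemma4 O k n _ n≡2^k keys keys-sorted κ' κ'' κ'≤κ'' s _ _ _ l₀ ((l₀≤k , 2^l₀∣s) , _) _ xs xs! witnessed =
  subst (length xs ≤_) (+-comm 1 l₀)
    (length-≤-classes (suc l₀) proj₁ (λ c → s≤s (proj₁ (proj₂ c))) same-class⇒≡ xs! (All.map classify witnessed))
  where
  open Receiver O k n keys κ' κ'' keys-sorted κ'≤κ'' (λ t → subst (rev k t <_) (sym n≡2^k) (rev-< k t))
  open From s

  Classified : ℤ → Set
  Classified x = ∃[ i ] (i ≤ l₀ × ∃[ d ] (InBlock i d × LbChangesAt (s + d) × x ≡ lb (suc (s + d)) - + 1))

  classify : ∀ {x} → ∃[ t ] ((s ≤ t × t < s + 2 ^ l₀) × (x ≡ lb (suc t) - + 1 × x ≢ lb t - + 1)) → Classified x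
  classify (t , (s≤t , t<) , x≡ , x≢) with m≤n⇒∃[o]m+o≡n s≤t
  ... | d , refl = let i , i≤l₀ , d∈i = block-of l₀ (+-cancelˡ-< s d (2 ^ l₀) t<) in
                   i , i≤l₀ , d , d∈i , (λ eq → x≢ (trans x≡ (cong (_- + 1) eq))) , x≡

  same-class⇒≡ : ∀ {x y} (cx : Classified x) (cy : Classified y) → proj₁ cx ≡ proj₁ cy → x ≡ y
  same-class⇒≡ (i , i≤l₀ , d₁ , d₁∈i , ch₁ , x≡) (_ , _ , d₂ , d₂∈i , ch₂ , y≡) refl =
    trans x≡ (trans (cong (λ d → lb (suc (s + d)) - + 1) d₁≡d₂) (sym y≡))
    where
    d₁≡d₂ : d₁ ≡ d₂
    d₁≡d₂ = change-unique-in-block (≤-trans i≤l₀ l₀≤k) (∣-trans (^-monoʳ-∣ 2 i≤l₀) 2^l₀∣s) d₁∈i d₂∈i ch₁ ch₂
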